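{- Let $H$ be an instance hypergraph of MTRS-minDist (as described in the context) such that: (i) $|\Delta|=|R|$ and for every $\eta\in\Delta$ and every $r\in R$, $\{\eta,r\}$ is an edge of $H$; (ii) $w(e)\ge 1$ for every edge $e$; (iii) the edges are closed under nonempty subsets of riders and weights are monotone under this (see context); and (iv) $\lambda=\max_{\eta\in D}\lambda_\eta\ge 2$. Let $M$ be the solution output by Algorithm GreedyMinDist and $M^*$ an optimal solution of MTRS-minDist. Then $$\frac{w(M)}{w(M^*)}\le\frac{\lambda^2\mu+\lambda}{\lambda+1},\qquad\text{where } \mu=\frac{\max_{e\in E(H)}w(e)}{\min_{e\in E(H)}w(e)}.$$
   Context: An instance of MTRS-minDist: finite sets $R$ (riders) and $D=\Gamma\cup\Delta$ (drivers, personal and designated, $\Gamma\cap\Delta=\emptyset$), each driver $\eta$ with capacity $\lambda_\eta\ge1$; a hypergraph $H$ with vertex set $D\cup R$ whose edges (feasible matches) are sets $\{\eta\}\cup S$ with $\eta\in D$, $\emptyset\neq S\subseteq R$, $|S|\le\lambda_\eta$, each edge $e$ having an integer weight $w(e)$; for $e=\{\eta\}\cup S$ write $D(e)=\eta$, $R(e)=S$; for a set $M$ of edges $w(M)=\sum_{e\in M}w(e)$. Closure: if $\{\eta\}\cup S$ is an edge with $|S|\ge2$ then $\{\eta\}\cup S'$ is an edge for every nonempty $S'\subseteq S$. Monotonicity: for edges $e,e'$ with $D(e)=D(e')$ and $R(e')\subseteq R(e)$, $w(e')\le w(e)$. A feasible solution is a set of pairwise vertex-disjoint edges covering every rider; an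 optimal solution is a feasible solution of minimum total weight. Algorithm GreedyMinDist computes two sets $M_1,M_2$ and outputs $M\in\{M_1,M_2\}$ with $w(M)=\min\{w(M_1),w(M_2)\}$. $M_1$: start with $M_1=\emptyset$ and the original $H$; repeatedly select an edge $e$ of the current hypergraph with minimum $w(e)$, add it to $M_1$, and delete all vertices of $e$ and all edges containing a vertex of $e$; stop when every rider is covered by $M_1$. $M_2$: the same procedure starting from the original $H$, but selecting in each iteration an edge minimizing $w(e)/|R(e)|$. -}

module Defs where

open import Data.Nat using (ℕ; _+_; _*_; _≤_; _⊓_)
open import Data.Fin using (Fin)
open import Data.Fin.Subset using (Subset; _∈_; _∉_; _⊆_; _∩_; ∣_∣; Nonempty; Empty; ⁅_⁆)
open import Data.Product using (_×_; _,_; proj₁; proj₂; ∃; Σ)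
open import Data.List using (List; []; _∷_; map)
open import Data.Nat.ListAction using (sum)
open import Data.List.Relation.Unary.Any using (Any)
open import Data.List.Relation.Unary.All using (All)
open import Data.List.Relation.Unary.AllPairs using (AllPairs)
open import Data.Unit using (⊤)
open import Relation.Binary.PropositionalEquality using (_≡_; _≢_)

-- Riders R = Fin n, drivers D = Fin m.  A (candidate) edge {η} ∪ S is a pair (η , S).
Edge : ℕ → ℕ → Set
Edge m n = Fin m × Subset n

D[_] : ∀ {m n} → Edge m n → Fin m
D[ e ] = proj₁ e

R[_] : ∀ {m n} → Edge m n → Subset n
R[ e ] = proj₂ e

record Instance (m n : ℕ) : Set₁ where
  field
    Δ      : Subset m                 -- designated drivers (Γ = complement)
    cap    : Fin m → ℕ
    IsEdge : Edge m n → Set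
    w      : Edge m n → ℕ             -- weights (only meaningful on edges)
    cap≥1        : ∀ η → 1 ≤ cap η
    edge-nonempty : ∀ e → IsEdge e → Nonempty R[ e ]
    edge-cap      : ∀ e → IsEdge e → ∣ R[ e ] ∣ ≤ cap D[ e ]

module _ {m n : ℕ} (I : Instance m n) where
  open Instance I

  weight : List (Edge m n) → ℕ
  weight M = sum (map w M)

  VertexDisjoint : Edge m n → Edge m n → Set
  VertexDisjoint e e' = D[ e ] ≢ D[ e' ] × Empty (R[ e ] ∩ R[ e' ])

  Covers : List (Edge m n) → Set
  Covers M = ∀ (r : Fin n) → Any (λ e → r ∈ R[ e ]) M

  Feasible : List (Edge m n) → Set
  Feasible M = All IsEdge M × AllPairs VertexDisjoint M × Covers M

  Optimal : List (Edge m n) → Set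
  Optimal M = Feasible M × (∀ M' → Feasible M' → weight M ≤ weight M')

  -- edge e is still present in the hypergraph after deleting the vertices of the
  -- previously selected edges `used`
  Available : List (Edge m n) → Edge m n → Set
  Available used e = IsEdge e × All (VertexDisjoint e) used

  -- A run of the greedy procedure with preference `pref` (pref e e' : "e is at
  -- least as good as e'"), given the already selected edges `used`; the list is
  -- the sequence of subsequently selected edges.  Ties are broken arbitrarily.
  GreedyFrom : (Edge m n → Edge m n → Set) → List (Edge m n) → List (Edge m n) → Set
  GreedyFrom pref used [] = ⊤
  GreedyFrom pref used (e ∷ es) =
    Available used e × (∀ e' → Available used e' → pref e e') × GreedyFrom pref (e ∷ used) es

  GreedyRun : (Edge m n → Edge m n → Set) → List (Edge m n) → Set
  GreedyRun pref M = GreedyFrom pref [] M × Covers M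

  prefW : Edge m n → Edge m n → Set
  prefW e e' = w e ≤ w e'

  -- M₂: minimise w(e)/|R(e)|  (cross-multiplied; |R(e)| ≥ 1 on edges)
  prefRatio : Edge m n → Edge m n → Set
  prefRatio e e' = w e * ∣ R[ e' ] ∣ ≤ w e' * ∣ R[ e ] ∣

  -- the output M of GreedyMinDist, given runs M₁ and M₂
  greedyMinDistWeight : List (Edge m n) → List (Edge m n) → ℕ
  greedyMinDistWeight M₁ M₂ = weight M₁ ⊓ weight M₂

  Hyp-i : Set
  Hyp-i = ∣ Δ ∣ ≡ n × (∀ η → η ∈ Δ → ∀ (r : Fin n) → IsEdge (η , ⁅ r ⁆))

  Hyp-ii : Set
  Hyp-ii = ∀ e → IsEdge e → 1 ≤ w e

  Closure : Set
  Closure = ∀ η S → IsEdge (η , S) → 2 ≤ ∣ S ∣ →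
            ∀ S' → Nonempty S' → S' ⊆ S → IsEdge (η , S')

  Monotone : Set
  Monotone = ∀ e e' → IsEdge e → IsEdge e' → D[ e ] ≡ D[ e' ] →
             R[ e' ] ⊆ R[ e ] → w e' ≤ w e

  IsMaxCap : ℕ → Set
  IsMaxCap λ' = (∀ η → cap η ≤ λ') × ∃ (λ η → cap η ≡ λ')

  IsMaxWeight : ℕ → Set
  IsMaxWeight W = (∀ e → IsEdge e → w e ≤ W) × ∃ (λ e → IsEdge e × w e ≡ W)

  IsMinWeight : ℕ → Set
  IsMinWeight W = (∀ e → IsEdge e → W ≤ w e) × ∃ (λ e → IsEdge e × w e ≡ W)

-- Charge every rider r, covered in M* by the edge o, the amount w(o) + λ·wmax while
-- the driver of o is unused and (λ+1)·wmax afterwards.  When the greedy procedure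
-- picks e, each rider of e releases a charge of at least w(e) + λ·wmax: its optimal
-- edge o, or the sub-edge {D(o), r} (closure and monotonicity), was still available,
-- so w(e) ≤ w(o).  The only optimal edge sharing the driver of e has at most λ riders,
-- whose charges grow by at most wmax − w(e) each.  Hence the total charge drops by at
-- least (λ+1)·w(e), which gives (λ+1)·w(M₁) ≤ Σ_{o ∈ M*} λ·(w(o) + λ·wmax), and
-- wmin ≤ w(o) yields the ratio.
module Submission where

open import Defs
open import Data.Nat using (ℕ; zero; suc; _+_; _*_; _∸_; _⊓_; _≤_; z≤n; s≤s)
open import Data.Nat.Properties hiding (_≟_)
open import Data.Nat.Tactic.RingSolver using (solve-∀)
open import Data.Nat.ListAction using (sum)
open import Algebra.Properties.CommutativeSemigroup +-commutativeSemigroup using (interchange)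
open import Algebra.Properties.CommutativeMonoid.Sum +-0-commutativeMonoid
  using (sum-syntax; ∑-distrib-+; sum-replicate-zero) renaming (sum to ∑)
open import Data.Bool using (Bool; true; false; _∧_; not; if_then_else_)
open import Data.Bool.Properties using (∨-conicalˡ; ∨-conicalʳ)
open import Data.Fin using (Fin; zero; suc; _≟_)
open import Data.Fin.Subset using (Subset; _∈_; _⊆_; _∩_; ∣_∣; Empty; ⁅_⁆)
open import Data.Fin.Subset.Properties using (x∈⁅x⁆; x∈⁅y⁆⇒x≡y; x∈p∩q⁻; x∈p∩q⁺)
open import Data.Vec.Base using ([]; _∷_; lookup; here; there)
open import Data.Vec.Properties using ([]=⇒lookup; lookup⇒[]=)
open import Data.List using (List; []; _∷_; map)
open import Data.Bool.ListAction using (any)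
open import Data.List.Relation.Unary.All as All using (All; []; _∷_)
open import Data.List.Relation.Unary.Any as Any using (Any)
open import Data.List.Relation.Unary.AllPairs as AllPairs using (AllPairs; []; _∷_)
open import Data.Product using (_×_; _,_; proj₁; proj₂; ∃-syntax)
open import Function using (_∘_)
open import Relation.Binary.Definitions using (DecidableEquality)
open import Relation.Binary.PropositionalEquality
open import Relation.Nullary using (does; yes; no; contradiction)
open import Relation.Nullary.Decidable using (dec-true; dec-false)

∑-mono-≤ : ∀ {n} {f g : Fin n → ℕ} → (∀ i → f i ≤ g i) → ∑ f ≤ ∑ g
∑-mono-≤ {zero}  f≤g = z≤n
∑-mono-≤ {suc n} f≤g = +-mono-≤ (f≤g zero) (∑-mono-≤ (f≤g ∘ suc))

term≤∑ : ∀ {n} (f : Fin n → ℕ) i → f i ≤ ∑ f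
term≤∑ f zero    = m≤m+n _ _
term≤∑ f (suc i) = ≤-trans (term≤∑ (f ∘ suc) i) (m≤n+m _ _)

∑-indicator : ∀ {n} (S : Subset n) k → ∑[ i < n ] (if lookup S i then k else 0) ≡ ∣ S ∣ * k
∑-indicator []          k = refl
∑-indicator (true ∷ S)  k = cong (k +_) (∑-indicator S k)
∑-indicator (false ∷ S) k = ∑-indicator S k

module _ {A : Set} where

  sum-map-mono-≤ : ∀ {f g : A → ℕ} {L} → All (λ x → f x ≤ g x) L →
                   sum (map f L) ≤ sum (map g L)
  sum-map-mono-≤ []           = z≤n
  sum-map-mono-≤ (fx≤gx ∷ ps) = +-mono-≤ fx≤gx (sum-map-mono-≤ ps)

  sum-map-+ : ∀ (f g : A → ℕ) L →
              sum (map (λ x → f x + g x) L) ≡ sum (map f L) + sum (map g L)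
  sum-map-+ f g []      = refl
  sum-map-+ f g (x ∷ L) = trans (cong (f x + g x +_) (sum-map-+ f g L)) (interchange (f x) (g x) _ _)

  sum-map-*ˡ : ∀ k (f : A → ℕ) L → sum (map (λ x → k * f x) L) ≡ k * sum (map f L)
  sum-map-*ˡ k f []      = sym (*-zeroʳ k)
  sum-map-*ˡ k f (x ∷ L) = trans (cong (k * f x +_) (sum-map-*ˡ k f L))
                                 (sym (*-distribˡ-+ k (f x) _))

  Any-≤⇒≤sum-map : ∀ {f : A → ℕ} {k L} → Any (λ x → k ≤ f x) L → k ≤ sum (map f L)
  Any-≤⇒≤sum-map (Any.here k≤fx) = ≤-trans k≤fx (m≤m+n _ _)
  Any-≤⇒≤sum-map (Any.there k≤f[L]) = ≤-trans (Any-≤⇒≤sum-map k≤f[L]) (m≤n+m _ _)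

  -- At most one element of a list with pairwise distinct keys can have key k.
  sum-map-key-indicator-≤ : ∀ {B : Set} (_≟ᴮ_ : DecidableEquality B) (key : A → B) k K {L} →
    AllPairs (λ a b → key a ≢ key b) L →
    sum (map (λ x → if does (k ≟ᴮ key x) then K else 0) L) ≤ K
  sum-map-key-indicator-≤ _≟ᴮ_ key k K []             = z≤n
  sum-map-key-indicator-≤ _≟ᴮ_ key k K {x ∷ L} (x≢L ∷ distinct) with k ≟ᴮ key x
  ... | no  _   = sum-map-key-indicator-≤ _≟ᴮ_ key k K distinct
  ... | yes k≡x = ≤-reflexive (trans (cong (K +_) (others-vanish x≢L)) (+-identityʳ K))
    where
    others-vanish : ∀ {L} → All (λ y → key x ≢ key y) L →
                    sum (map (λ y → if does (k ≟ᴮ key y) then K else 0) L) ≡ 0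
    others-vanish []                      = refl
    others-vanish {y ∷ L} (x≢y ∷ x≢L) rewrite dec-false (k ≟ᴮ key y) (x≢y ∘ trans (sym k≡x)) =
      others-vanish x≢L

x∈p⇒1≤∣p∣ : ∀ {n} {p : Subset n} {x} → x ∈ p → 1 ≤ ∣ p ∣
x∈p⇒1≤∣p∣ {p = true ∷ p}  here      = s≤s z≤n
x∈p⇒1≤∣p∣ {p = true ∷ p}  (there q) = m≤n⇒m≤1+n (x∈p⇒1≤∣p∣ q)
x∈p⇒1≤∣p∣ {p = false ∷ p} (there q) = x∈p⇒1≤∣p∣ q

∣p∣≤1⇒x∈p⇒y∈p⇒x≡y : ∀ {n} (p : Subset n) {x y} → ∣ p ∣ ≤ 1 → x ∈ p → y ∈ p → x ≡ y
∣p∣≤1⇒x∈p⇒y∈p⇒x≡y (true ∷ p)  _           here      here       = refl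
∣p∣≤1⇒x∈p⇒y∈p⇒x≡y (true ∷ p)  (s≤s ∣p∣≤0) here      (there q)  =
  contradiction (≤-trans (x∈p⇒1≤∣p∣ q) ∣p∣≤0) 1+n≰n
∣p∣≤1⇒x∈p⇒y∈p⇒x≡y (true ∷ p)  (s≤s ∣p∣≤0) (there q) _          =
  contradiction (≤-trans (x∈p⇒1≤∣p∣ q) ∣p∣≤0) 1+n≰n
∣p∣≤1⇒x∈p⇒y∈p⇒x≡y (false ∷ p) ∣p∣≤1       (there q) (there q') =
  cong suc (∣p∣≤1⇒x∈p⇒y∈p⇒x≡y p ∣p∣≤1 q q')

m≤n⇒n+k≡m+k+[n∸m] : ∀ {m n} k → m ≤ n → n + k ≡ m + k + (n ∸ m)
m≤n⇒n+k≡m+k+[n∸m] {m} {n} k m≤n = begin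
  n + k                ≡⟨ cong (_+ k) (m+[n∸m]≡n m≤n) ⟨
  m + (n ∸ m) + k      ≡⟨ +-assoc m (n ∸ m) k ⟩
  m + ((n ∸ m) + k)    ≡⟨ cong (m +_) (+-comm (n ∸ m) k) ⟩
  m + (k + (n ∸ m))    ≡⟨ +-assoc m k (n ∸ m) ⟨
  m + k + (n ∸ m)      ∎
  where open ≡-Reasoning

gain-minus-loss : ∀ {c W} lam {gain loss} → c ≤ W → c + lam * W ≤ gain → loss ≤ lam * (W ∸ c) →
                  suc lam * c + loss ≤ gain
gain-minus-loss {c} {W} lam {gain} {loss} c≤W gain≥ loss≤ = begin
  suc lam * c + loss               ≤⟨ +-monoʳ-≤ (suc lam * c) loss≤ ⟩
  c + lam * c + lam * (W ∸ c)      ≡⟨ +-assoc c (lam * c) _ ⟩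
  c + (lam * c + lam * (W ∸ c))    ≡⟨ cong (c +_) (*-distribˡ-+ lam c (W ∸ c)) ⟨
  c + lam * (c + (W ∸ c))          ≡⟨ cong (λ x → c + lam * x) (m+[n∸m]≡n c≤W) ⟩
  c + lam * W                      ≤⟨ gain≥ ⟩
  gain                             ∎
  where open ≤-Reasoning

initial-charge-vs-weight : ∀ {A : Set} (w : A → ℕ) lam W {wmin L} → All (λ o → wmin ≤ w o) L →
  wmin * sum (map (λ o → lam * (w o + lam * W)) L) ≤ (lam * lam * W + lam * wmin) * sum (map w L)
initial-charge-vs-weight w lam W {wmin} {L} wmin≤w = begin
  wmin * sum (map (λ o → lam * (w o + lam * W)) L)    ≡⟨ sum-map-*ˡ wmin _ L ⟨
  sum (map (λ o → wmin * (lam * (w o + lam * W))) L)  ≤⟨ sum-map-mono-≤ (All.map per-edge wmin≤w) ⟩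
  sum (map (λ o → (lam * lam * W + lam * wmin) * w o) L) ≡⟨ sum-map-*ˡ (lam * lam * W + lam * wmin) w L ⟩
  (lam * lam * W + lam * wmin) * sum (map w L)        ∎
  where
  open ≤-Reasoning
  expand : ∀ a x l W → a * (l * (x + l * W)) ≡ l * l * W * a + l * a * x
  expand = solve-∀
  factor : ∀ a x l W → l * l * W * x + l * a * x ≡ (l * l * W + l * a) * x
  factor = solve-∀
  per-edge : ∀ {x} → wmin ≤ x → wmin * (lam * (x + lam * W)) ≤ (lam * lam * W + lam * wmin) * x
  per-edge {x} wmin≤x = begin
    wmin * (lam * (x + lam * W))              ≡⟨ expand wmin x lam W ⟩
    lam * lam * W * wmin + lam * wmin * x     ≤⟨ +-monoˡ-≤ _ (*-monoʳ-≤ (lam * lam * W) wmin≤x) ⟩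
    lam * lam * W * x + lam * wmin * x        ≡⟨ factor wmin x lam W ⟩
    (lam * lam * W + lam * wmin) * x          ∎

coveredᵇ : ∀ {m n} → List (Edge m n) → Fin n → Bool
coveredᵇ U r = any (λ u → lookup R[ u ] r) U

usedᵇ : ∀ {m n} → List (Edge m n) → Fin m → Bool
usedᵇ U η = any (λ u → does (D[ u ] ≟ η)) U

module _ {m n : ℕ} (I : Instance m n) where
  open Instance I

  disjoint⇒unused : ∀ {e} U → All (VertexDisjoint I e) U → usedᵇ U D[ e ] ≡ false
  disjoint⇒unused         []      []                  = refl
  disjoint⇒unused {e} (u ∷ U) ((e≢u , _) ∷ e#U) rewrite dec-false (D[ u ] ≟ D[ e ]) (e≢u ∘ sym) =
    disjoint⇒unused U e#U

  disjoint⇒uncovered : ∀ {e r} U → All (VertexDisjoint I e) U → r ∈ R[ e ] → coveredᵇ U r ≡ false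
  disjoint⇒uncovered         []      []                  _   = refl
  disjoint⇒uncovered {e} {r} (u ∷ U) ((_ , e∩u≡∅) ∷ e#U) r∈e with lookup R[ u ] r in r∈?u
  ... | true  = contradiction (r , x∈p∩q⁺ (r∈e , lookup⇒[]= r R[ u ] r∈?u)) e∩u≡∅
  ... | false = disjoint⇒uncovered U e#U r∈e

  unused∧uncovered⇒disjoint : ∀ {η S} U → usedᵇ U η ≡ false →
    (∀ {r} → r ∈ S → coveredᵇ U r ≡ false) → All (VertexDisjoint I (η , S)) U
  unused∧uncovered⇒disjoint             []      _      _         = []
  unused∧uncovered⇒disjoint {η} {S} (u ∷ U) unused uncovered =
    (η≢u , S∩u≡∅) ∷ unused∧uncovered⇒disjoint U (∨-conicalʳ _ _ unused) (∨-conicalʳ _ _ ∘ uncovered)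
    where
    η≢u : η ≢ D[ u ]
    η≢u η≡u with () ← trans (sym (dec-true (D[ u ] ≟ η) (sym η≡u))) (∨-conicalˡ _ (usedᵇ U η) unused)
    S∩u≡∅ : Empty (S ∩ R[ u ])
    S∩u≡∅ (r , r∈S∩u) with x∈p∩q⁻ S R[ u ] r∈S∩u
    ... | r∈S , r∈u with () ← trans (sym ([]=⇒lookup r∈u)) (∨-conicalˡ _ (coveredᵇ U r) (uncovered r∈S))

  -- The witness is o itself if it has a single rider, otherwise its sub-edge {D(o), r}.
  available-below : Closure I → Monotone I → ∀ {o r} U → IsEdge o → r ∈ R[ o ] →
    usedᵇ U D[ o ] ≡ false → coveredᵇ U r ≡ false → ∃[ e ] Available I U e × w e ≤ w o
  available-below closure monotone {o} {r} U o∈E r∈o unused uncovered with 2 ≤? ∣ R[ o ] ∣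
  ... | yes 2≤∣o∣ = single , (single∈E , disjoint) , monotone o single o∈E single∈E refl ⁅r⁆⊆o
    where
    single : Edge m n
    single = D[ o ] , ⁅ r ⁆
    ⁅r⁆⊆o : ⁅ r ⁆ ⊆ R[ o ]
    ⁅r⁆⊆o x∈⁅r⁆ = subst (_∈ R[ o ]) (sym (x∈⁅y⁆⇒x≡y r x∈⁅r⁆)) r∈o
    single∈E : IsEdge single
    single∈E = closure D[ o ] R[ o ] o∈E 2≤∣o∣ ⁅ r ⁆ (r , x∈⁅x⁆ r) ⁅r⁆⊆o
    disjoint : All (VertexDisjoint I single) U
    disjoint = unused∧uncovered⇒disjoint U unused
      (λ x∈⁅r⁆ → subst (λ x → coveredᵇ U x ≡ false) (sym (x∈⁅y⁆⇒x≡y r x∈⁅r⁆)) uncovered)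
  ... | no  2≰∣o∣ = o , (o∈E , disjoint) , ≤-refl
    where
    disjoint : All (VertexDisjoint I o) U
    disjoint = unused∧uncovered⇒disjoint U unused λ x∈o →
      subst (λ x → coveredᵇ U x ≡ false) (∣p∣≤1⇒x∈p⇒y∈p⇒x≡y R[ o ] (≤-pred (≰⇒> 2≰∣o∣)) r∈o x∈o) uncovered

module Charging {m n : ℕ} (I : Instance m n) (closure : Closure I) (monotone : Monotone I)
  (lam wmax : ℕ) (cap≤lam : ∀ η → Instance.cap I η ≤ lam)
  (w≤wmax : ∀ e → Instance.IsEdge I e → Instance.w I e ≤ wmax)
  {Mopt : List (Edge m n)} (opt : Feasible I Mopt) where

  open Instance I

  rate : Edge m n → List (Edge m n) → ℕ
  rate o U = if usedᵇ U D[ o ] then suc lam * wmax else w o + lam * wmax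

  charge : Edge m n → List (Edge m n) → Fin n → ℕ
  charge o U r = if lookup R[ o ] r ∧ not (coveredᵇ U r) then rate o U else 0

  Φ : List (Edge m n) → ℕ
  Φ U = sum (map (λ o → ∑ (charge o U)) Mopt)

  Mopt⊆E : All IsEdge Mopt
  Mopt⊆E = proj₁ opt

  Mopt-drivers-distinct : AllPairs (λ a b → D[ a ] ≢ D[ b ]) Mopt
  Mopt-drivers-distinct = AllPairs.map proj₁ (proj₁ (proj₂ opt))

  ∑-on-riders≤ : ∀ {o} → IsEdge o → ∀ k {f : Fin n → ℕ} →
                 (∀ r → f r ≤ (if lookup R[ o ] r then k else 0)) → ∑ f ≤ lam * k
  ∑-on-riders≤ {o} o∈E k {f} f≤ = begin
    ∑ f                                       ≤⟨ ∑-mono-≤ f≤ ⟩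
    ∑ (λ r → if lookup R[ o ] r then k else 0) ≡⟨ ∑-indicator R[ o ] k ⟩
    ∣ R[ o ] ∣ * k                             ≤⟨ *-monoˡ-≤ k (≤-trans (edge-cap o o∈E) (cap≤lam D[ o ])) ⟩
    lam * k                                   ∎
    where open ≤-Reasoning

  Φ-initial : Φ [] ≤ sum (map (λ o → lam * (w o + lam * wmax)) Mopt)
  Φ-initial = sum-map-mono-≤ (All.map (λ o∈E → ∑-on-riders≤ o∈E _ (pointwise _)) Mopt⊆E)
    where
    pointwise : ∀ o r → charge o [] r ≤ (if lookup R[ o ] r then w o + lam * wmax else 0)
    pointwise o r with lookup R[ o ] r
    ... | true  = ≤-refl
    ... | false = z≤n

  module Step {e : Edge m n} {U : List (Edge m n)} (e-available : Available I U e)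
              (e-minimal : ∀ e' → Available I U e' → w e ≤ w e') where

    e∈E : IsEdge e
    e∈E = proj₁ e-available

    e#U : All (VertexDisjoint I e) U
    e#U = proj₂ e-available

    driver-of-e-unused : ∀ {η} → D[ e ] ≡ η → usedᵇ U η ≡ false
    driver-of-e-unused refl = disjoint⇒unused I U e#U

    rider-of-e-uncovered : ∀ {r} → r ∈ R[ e ] → coveredᵇ U r ≡ false
    rider-of-e-uncovered = disjoint⇒uncovered I U e#U

    w[e]≤live : ∀ {o r} → IsEdge o → r ∈ R[ o ] →
                usedᵇ U D[ o ] ≡ false → coveredᵇ U r ≡ false → w e ≤ w o
    w[e]≤live o∈E r∈o unused uncovered
      with e' , e'-available , w[e']≤w[o] ← available-below I closure monotone U o∈E r∈o unused uncovered
      = ≤-trans (e-minimal e' e'-available) w[e']≤w[o]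

    rate≥ : ∀ {o r} → IsEdge o → r ∈ R[ o ] → coveredᵇ U r ≡ false → w e + lam * wmax ≤ rate o U
    rate≥ {o} o∈E r∈o uncovered with usedᵇ U D[ o ] in used?
    ... | true  = +-monoˡ-≤ (lam * wmax) (w≤wmax e e∈E)
    ... | false = +-monoˡ-≤ (lam * wmax) (w[e]≤live o∈E r∈o used? uncovered)

    gain : Edge m n → Fin n → ℕ
    gain o r = if lookup R[ e ] r ∧ lookup R[ o ] r then w e + lam * wmax else 0

    loss : Edge m n → Fin n → ℕ
    loss o r = if does (D[ e ] ≟ D[ o ]) ∧ (lookup R[ o ] r ∧ not (coveredᵇ U r)) then wmax ∸ w o else 0

    charge-step : ∀ {o} → IsEdge o → ∀ r → charge o (e ∷ U) r + gain o r ≤ charge o U r + loss o r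
    charge-step {o} o∈E r with lookup R[ o ] r in r∈?o | lookup R[ e ] r in r∈?e
    ... | false | true  = z≤n
    ... | false | false = z≤n
    ... | true  | true  rewrite rider-of-e-uncovered (lookup⇒[]= r R[ e ] r∈?e) =
      ≤-trans (rate≥ o∈E (lookup⇒[]= r R[ o ] r∈?o) (rider-of-e-uncovered (lookup⇒[]= r R[ e ] r∈?e)))
              (m≤m+n _ _)
    ... | true  | false with coveredᵇ U r
    ...   | true  = z≤n
    ...   | false with D[ e ] ≟ D[ o ]
    ...     | no  _   = ≤-refl
    ...     | yes e≡o rewrite driver-of-e-unused e≡o =
      ≤-reflexive (trans (+-identityʳ _) (m≤n⇒n+k≡m+k+[n∸m] (lam * wmax) (w≤wmax o o∈E)))

    ∑loss≤ : ∀ {o} → IsEdge o → ∑ (loss o) ≤ (if does (D[ e ] ≟ D[ o ]) then lam * (wmax ∸ w e) else 0)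
    ∑loss≤ {o} o∈E with D[ e ] ≟ D[ o ]
    ... | no  _   = ≤-reflexive (sum-replicate-zero n)
    ... | yes e≡o = ∑-on-riders≤ o∈E (wmax ∸ w e) pointwise
      where
      pointwise : ∀ r → (if lookup R[ o ] r ∧ not (coveredᵇ U r) then wmax ∸ w o else 0)
                        ≤ (if lookup R[ o ] r then wmax ∸ w e else 0)
      pointwise r with lookup R[ o ] r in r∈?o | coveredᵇ U r in covered?
      ... | false | _     = z≤n
      ... | true  | true  = z≤n
      ... | true  | false = ∸-monoʳ-≤ wmax (w[e]≤live o∈E (lookup⇒[]= r R[ o ] r∈?o) (driver-of-e-unused e≡o) covered?)

    total-gain≥ : w e + lam * wmax ≤ sum (map (∑ ∘ gain) Mopt)
    total-gain≥ = Any-≤⇒≤sum-map {f = ∑ ∘ gain} (Any.map (λ {o} → gain-at-r {o}) (proj₂ (proj₂ opt) r))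
      where
      r : Fin n
      r = proj₁ (edge-nonempty e e∈E)
      gain-at-r : ∀ {o} → r ∈ R[ o ] → w e + lam * wmax ≤ ∑ (gain o)
      gain-at-r {o} r∈o = subst (_≤ ∑ (gain o)) gain≡ (term≤∑ (gain o) r)
        where
        gain≡ : gain o r ≡ w e + lam * wmax
        gain≡ rewrite []=⇒lookup (proj₂ (edge-nonempty e e∈E)) | []=⇒lookup r∈o = refl

    total-loss≤ : sum (map (∑ ∘ loss) Mopt) ≤ lam * (wmax ∸ w e)
    total-loss≤ = ≤-trans (sum-map-mono-≤ (All.map ∑loss≤ Mopt⊆E))
                          (sum-map-key-indicator-≤ _≟_ D[_] D[ e ] _ Mopt-drivers-distinct)

    Φ-step : Φ (e ∷ U) + sum (map (∑ ∘ gain) Mopt) ≤ Φ U + sum (map (∑ ∘ loss) Mopt)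
    Φ-step = begin
      Φ (e ∷ U) + sum (map (∑ ∘ gain) Mopt)                        ≡⟨ sum-map-+ _ _ Mopt ⟨
      sum (map (λ o → ∑ (charge o (e ∷ U)) + ∑ (gain o)) Mopt)    ≤⟨ sum-map-mono-≤ (All.map per-edge Mopt⊆E) ⟩
      sum (map (λ o → ∑ (charge o U) + ∑ (loss o)) Mopt)          ≡⟨ sum-map-+ _ _ Mopt ⟩
      Φ U + sum (map (∑ ∘ loss) Mopt)                              ∎
      where
      open ≤-Reasoning
      per-edge : ∀ {o} → IsEdge o → ∑ (charge o (e ∷ U)) + ∑ (gain o) ≤ ∑ (charge o U) + ∑ (loss o)
      per-edge {o} o∈E = begin
        ∑ (charge o (e ∷ U)) + ∑ (gain o)           ≡⟨ ∑-distrib-+ (charge o (e ∷ U)) (gain o) ⟨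
        ∑[ r < n ] (charge o (e ∷ U) r + gain o r)  ≤⟨ ∑-mono-≤ (charge-step o∈E) ⟩
        ∑[ r < n ] (charge o U r + loss o r)        ≡⟨ ∑-distrib-+ (charge o U) (loss o) ⟩
        ∑ (charge o U) + ∑ (loss o)                 ∎

    Φ-decrease : Φ (e ∷ U) + suc lam * w e ≤ Φ U
    Φ-decrease = +-cancelʳ-≤ (sum (map (∑ ∘ loss) Mopt)) _ _ (begin
      Φ (e ∷ U) + suc lam * w e + sum (map (∑ ∘ loss) Mopt)
        ≡⟨ +-assoc (Φ (e ∷ U)) _ _ ⟩
      Φ (e ∷ U) + (suc lam * w e + sum (map (∑ ∘ loss) Mopt))
        ≤⟨ +-monoʳ-≤ (Φ (e ∷ U)) (gain-minus-loss lam (w≤wmax e e∈E) total-gain≥ total-loss≤) ⟩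
      Φ (e ∷ U) + sum (map (∑ ∘ gain) Mopt)
        ≤⟨ Φ-step ⟩
      Φ U + sum (map (∑ ∘ loss) Mopt) ∎)
      where open ≤-Reasoning

  greedy-weight≤Φ : ∀ U {es} → GreedyFrom I (prefW I) U es → suc lam * weight I es ≤ Φ U
  greedy-weight≤Φ U {[]}     _ = subst (_≤ Φ U) (sym (*-zeroʳ (suc lam))) z≤n
  greedy-weight≤Φ U {e ∷ es} (e-available , e-minimal , run) = begin
    suc lam * (w e + weight I es)          ≡⟨ *-distribˡ-+ (suc lam) (w e) (weight I es) ⟩
    suc lam * w e + suc lam * weight I es  ≤⟨ +-monoʳ-≤ (suc lam * w e) (greedy-weight≤Φ (e ∷ U) run) ⟩
    suc lam * w e + Φ (e ∷ U)              ≡⟨ +-comm (suc lam * w e) (Φ (e ∷ U)) ⟩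
    Φ (e ∷ U) + suc lam * w e              ≤⟨ Step.Φ-decrease e-available e-minimal ⟩
    Φ U                                    ∎
    where open ≤-Reasoning

-- The bound already holds for M₁ alone.
theorem3 : ∀ {m n} (I : Instance m n) →
    Hyp-i I → Hyp-ii I → Closure I → Monotone I →
    ∀ (lam : ℕ) → IsMaxCap I lam → 2 ≤ lam →
    ∀ (wmax wmin : ℕ) → IsMaxWeight I wmax → IsMinWeight I wmin →
    ∀ (M₁ M₂ Mopt : List (Edge m n)) →
    GreedyRun I (prefW I) M₁ → GreedyRun I (prefRatio I) M₂ → Optimal I Mopt →
    greedyMinDistWeight I M₁ M₂ * ((lam + 1) * wmin)
      ≤ (lam * lam * wmax + lam * wmin) * weight I Mopt
theorem3 I _ _ closure monotone lam (cap≤lam , _) _ wmax wmin (w≤wmax , _) (wmin≤w , _)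
         M₁ M₂ Mopt (greedy₁ , _) _ (opt , _) = begin
  (weight I M₁ ⊓ weight I M₂) * ((lam + 1) * wmin)  ≤⟨ *-monoˡ-≤ _ (m⊓n≤m (weight I M₁) (weight I M₂)) ⟩
  weight I M₁ * ((lam + 1) * wmin)                  ≡⟨ rearrange (weight I M₁) lam wmin ⟩
  wmin * (suc lam * weight I M₁)                    ≤⟨ *-monoʳ-≤ wmin (≤-trans (C.greedy-weight≤Φ [] greedy₁) C.Φ-initial) ⟩
  wmin * sum (map (λ o → lam * (w o + lam * wmax)) Mopt)
    ≤⟨ initial-charge-vs-weight w lam wmax (All.map (λ {o} → wmin≤w o) (proj₁ opt)) ⟩
  (lam * lam * wmax + lam * wmin) * weight I Mopt   ∎
  where
  open ≤-Reasoning
  open Instance I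
  module C = Charging I closure monotone lam wmax cap≤lam w≤wmax opt
  rearrange : ∀ a l b → a * ((l + 1) * b) ≡ b * (suc l * a)
  rearrange = solve-∀
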